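{- Let $n \geq 1$ and $1 \leq m \leq n$ be integers. Then the suffix length $S(n,m)$ of $\mathcal{A}(n,m)$ satisfies $S(n,m) = 2\,|\mathcal{A}(n,m)| - 1$.
   Context: An ascending composition of a positive integer $n$ is a sequence of positive integers $(a_1,\dots,a_k)$ with $k \geq 1$, $a_1 + \dots + a_k = n$ and $a_1 \leq \dots \leq a_k$. For $1 \leq m \leq n$, $\mathcal{A}(n,m)$ is the set of ascending compositions of $n$ with $a_1 \geq m$. List the elements of $\mathcal{A}(n,m)$ in lexicographic order as $b^{(1)}, b^{(2)}, \dots, b^{(N)}$ (where $N = |\mathcal{A}(n,m)|$, and a proper prefix precedes its extensions). The suffix length $S(n,m)$ is the total number of parts written when generating this list in order: $S(n,m) = \ell(b^{(1)}) + \sum_{i=1}^{N-1} \bigl(\ell(b^{(i+1)}) - c_i\bigr)$, where $\ell(b)$ is the number of parts of $b$ and $c_i$ is the length of the longest common prefix of $b^{(i)}$ and $b^{(i+1)}$. -}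

module Defs where

open import Data.Nat using (ℕ; zero; suc; _+_; _*_; _∸_; _≤_; _<_; _≟_)
open import Data.List using (List; []; _∷_; length)
open import Data.Nat.ListAction using (sum)
open import Data.List.Relation.Unary.All using (All)
open import Data.List.Relation.Unary.Linked using (Linked)
open import Data.List.Relation.Binary.Lex.Strict using (Lex-<)
open import Data.Product using (_×_)
open import Relation.Binary.PropositionalEquality using (_≡_)
open import Relation.Nullary using (yes; no)

data IsAscComp (n : ℕ) : List ℕ → Set where
  asc : ∀ a rest →
        All (1 ≤_) (a ∷ rest) →
        sum (a ∷ rest) ≡ n →
        Linked _≤_ (a ∷ rest) →
        IsAscComp n (a ∷ rest)

data InA (n m : ℕ) : List ℕ → Set where
  inA : ∀ a rest → IsAscComp n (a ∷ rest) → m ≤ a → InA n m (a ∷ rest)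

-- strict lexicographic order on compositions; a proper prefix precedes its extensions
_<lex_ : List ℕ → List ℕ → Set
_<lex_ = Lex-< _≡_ _<_

lcp : List ℕ → List ℕ → ℕ
lcp [] _ = 0
lcp (_ ∷ _) [] = 0
lcp (x ∷ xs) (y ∷ ys) with x ≟ y
... | yes _ = suc (lcp xs ys)
... | no _ = 0

suffixRest : List ℕ → List (List ℕ) → ℕ
suffixRest _ [] = 0
suffixRest b (b' ∷ bs) = (length b' ∸ lcp b b') + suffixRest b' bs

suffixLength : List (List ℕ) → ℕ
suffixLength [] = 0
suffixLength (b ∷ bs) = length b + suffixRest b bs

-- Splitting on the first part gives 𝒜(n,m) = m·𝒜(n−m,m) ∪ 𝒜(n,m+1) when 2m ≤ n, and
-- 𝒜(n,m) = {(n)} otherwise, and in lexicographic order the first block precedes the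
-- second. Writing m·𝒜(n−m,m) costs one part more than writing 𝒜(n−m,m) (the common
-- prefix m is written once), and the first word of 𝒜(n,m+1) shares no prefix with its
-- predecessor, so by induction S = 2N − 1 with the single-word listing as base case.
module Submission where

open import Defs
open import Data.Nat using (ℕ; zero; suc; _+_; _*_; _∸_; _≤_; _<_; z≤n; s≤s; _≟_; _≤?_)
open import Data.Nat.Properties
open import Data.Nat.ListAction using (sum)
open import Data.List using (List; []; _∷_; [_]; length; map; _++_)
open import Data.List.Properties using (length-map; length-++)
open import Data.List.Relation.Unary.All as All using (All; _∷_)
open import Data.List.Relation.Unary.AllPairs as AllPairs using (AllPairs; []; _∷_)
import Data.List.Relation.Unary.AllPairs.Properties as AllPairs
open import Data.List.Relation.Unary.Linked using (Linked; [-]; _∷_)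
open import Data.List.Relation.Unary.Linked.Properties using (Linked⇒AllPairs)
open import Data.List.Relation.Unary.Any using (here; there)
open import Data.List.Relation.Binary.Lex.Core using (this; next)
open import Data.List.Relation.Binary.Lex.Strict using (<-asymmetric; <-transitive)
open import Data.List.Membership.Propositional using (_∈_)
open import Data.List.Membership.Propositional.Properties using (∈-map⁺; ∈-map⁻; ∈-++⁺ˡ; ∈-++⁺ʳ; ∈-++⁻)
open import Data.Product using (∃-syntax; _×_; _,_)
open import Data.Sum using (_⊎_; inj₁; inj₂)
open import Data.Unit using (⊤)
open import Data.Empty using (⊥; ⊥-elim)
open import Function.Bundles using (_⇔_; mk⇔; Equivalence)
open import Function.Construct.Composition using (_⇔-∘_)
open import Function.Construct.Symmetry using (⇔-sym)
open import Relation.Binary.Definitions using (Asymmetric; Transitive)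
open import Relation.Binary.PropositionalEquality
  using (_≡_; refl; sym; trans; cong; cong₂; subst; isEquivalence; module ≡-Reasoning)
open import Relation.Nullary using (yes; no)

<lex-asym : Asymmetric _<lex_
<lex-asym = <-asymmetric sym <-resp₂-≡ <-asym

<lex-trans : Transitive _<lex_
<lex-trans = <-transitive isEquivalence <-resp₂-≡ <-trans

module _ {a r} {A : Set a} {_≺_ : A → A → Set r} (asym : Asymmetric _≺_) where

  strictlySorted-unique : ∀ {xs ys} → AllPairs _≺_ xs → AllPairs _≺_ ys →
                          (∀ z → z ∈ xs ⇔ z ∈ ys) → xs ≡ ys
  strictlySorted-unique {[]} {[]} _ _ _ = refl
  strictlySorted-unique {[]} {y ∷ _} _ _ xs⇔ys with Equivalence.from (xs⇔ys y) (here refl)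
  ... | ()
  strictlySorted-unique {x ∷ _} {[]} _ _ xs⇔ys with Equivalence.to (xs⇔ys x) (here refl)
  ... | ()
  strictlySorted-unique {x ∷ xs} {y ∷ ys} (x≺xs ∷ sxs) (y≺ys ∷ sys) xs⇔ys
    with heads-equal
    where
    heads-equal : x ≡ y
    heads-equal with Equivalence.to (xs⇔ys x) (here refl) | Equivalence.from (xs⇔ys y) (here refl)
    ... | here x≡y   | _          = x≡y
    ... | there _    | here y≡x   = sym y≡x
    ... | there x∈ys | there y∈xs = ⊥-elim (asym (All.lookup x≺xs y∈xs) (All.lookup y≺ys x∈ys))
  ... | refl = cong (x ∷_) (strictlySorted-unique sxs sys tails-equivalent)
    where
    ≺-irrefl : ∀ {z} → z ≺ z → ⊥
    ≺-irrefl z≺z = asym z≺z z≺z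
    below-head : ∀ {zs zs'} → All (x ≺_) zs → (∀ {w} → w ∈ zs → w ∈ x ∷ zs') →
                 ∀ {w} → w ∈ zs → w ∈ zs'
    below-head x≺zs zs⊆ w∈ with zs⊆ w∈
    ... | here refl = ⊥-elim (≺-irrefl (All.lookup x≺zs w∈))
    ... | there w∈zs' = w∈zs'
    tails-equivalent : ∀ z → z ∈ xs ⇔ z ∈ ys
    tails-equivalent z = mk⇔ (below-head x≺xs (λ w∈ → Equivalence.to (xs⇔ys _) (there w∈)))
                             (below-head y≺ys (λ w∈ → Equivalence.from (xs⇔ys _) (there w∈)))

InA-weaken : ∀ {n m b} → InA n (suc m) b → InA n m b
InA-weaken (inA a rest comp m<a) = inA a rest comp (<⇒≤ m<a)

InA-singleton : ∀ {n m} → 1 ≤ m → m ≤ n → InA n m [ n ]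
InA-singleton 1≤m m≤n = inA _ [] (asc _ [] (≤-trans 1≤m m≤n ∷ All.[]) (+-identityʳ _) [-]) m≤n

InA-cons : ∀ {n m c} → 1 ≤ m → m ≤ n → InA (n ∸ m) m c → InA n m (m ∷ c)
InA-cons {m = m} 1≤m m≤n (inA a rest (asc _ _ pos sum≡ linked) m≤a) =
  inA m (a ∷ rest)
      (asc m _ (1≤m ∷ pos) (trans (cong (m +_) sum≡) (m+[n∸m]≡n m≤n)) (m≤a ∷ linked)) ≤-refl

InA⇒≤ : ∀ {n m b} → InA n m b → m ≤ n
InA⇒≤ (inA a rest (asc _ _ _ sum≡ _) m≤a) = ≤-trans m≤a (≤-trans (m≤m+n a (sum rest)) (≤-reflexive sum≡))

InA-short : ∀ {n m b} → n < m + m → InA n m b → b ≡ [ n ]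
InA-short _ (inA a [] (asc _ _ _ sum≡ _) _) = cong [_] (trans (sym (+-identityʳ a)) sum≡)
InA-short {n} {m} n<2m (inA a (a' ∷ rest) (asc _ _ _ sum≡ (a≤a' ∷ _)) m≤a) =
  ⊥-elim (<⇒≱ n<2m (begin
    m + m          ≤⟨ +-mono-≤ m≤a (≤-trans m≤a a≤a') ⟩
    a + a'         ≤⟨ +-monoʳ-≤ a (m≤m+n a' (sum rest)) ⟩
    a + (a' + sum rest) ≡⟨ sum≡ ⟩
    n              ∎))
  where open ≤-Reasoning

InA-split : ∀ {n m b} → 1 ≤ m → m + m ≤ n → InA n m b →
            InA n (suc m) b ⊎ ∃[ c ] b ≡ m ∷ c × InA (n ∸ m) m c
InA-split _ _ (inA a rest comp m≤a) with m≤n⇒m<n∨m≡n m≤a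
... | inj₁ m<a = inj₁ (inA a rest comp m<a)
InA-split 1≤m 2m≤n (inA a [] (asc _ _ _ sum≡ _) _) | inj₂ refl =
  ⊥-elim (<⇒≱ (m<m+n a 1≤m) (≤-trans 2m≤n (≤-reflexive (trans (sym sum≡) (+-identityʳ a)))))
InA-split _ _ (inA a (a' ∷ rest) (asc _ _ (_ ∷ pos) sum≡ (a≤a' ∷ linked)) _) | inj₂ refl =
  inj₂ (a' ∷ rest , refl ,
        inA a' rest (asc a' rest pos (trans (sym (m+n∸m≡n a _)) (cong (_∸ a) sum≡)) linked) a≤a')

-- The first argument is fuel; n < fuel + m suffices to enumerate all of 𝒜(n,m).
listA : ℕ → ℕ → ℕ → List (List ℕ)
listA zero     n m = []
listA (suc f)  n m with m + m ≤? n | m ≤? n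
... | yes _ | _     = map (m ∷_) (listA f (n ∸ m) m) ++ listA f n (suc m)
... | no _  | yes _ = [ [ n ] ]
... | no _  | no _  = []

fuel-tail : ∀ {f n m} → 1 ≤ m → n < suc f + m → n ∸ m < f + m
fuel-tail {f} {n} {m} 1≤m (s≤s n≤f+m) = begin-strict
  n ∸ m       ≤⟨ ∸-monoˡ-≤ m n≤f+m ⟩
  f + m ∸ m   ≡⟨ m+n∸n≡m f m ⟩
  f           <⟨ m<m+n f 1≤m ⟩
  f + m       ∎
  where open ≤-Reasoning

fuel-next : ∀ {f n m} → n < suc f + m → n < f + suc m
fuel-next {f} {n} {m} n<f+1+m = ≤-trans n<f+1+m (≤-reflexive (sym (+-suc f m)))

1+m≤n : ∀ {n m} → 1 ≤ m → m + m ≤ n → suc m ≤ n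
1+m≤n {n} {m} 1≤m 2m≤n = ≤-trans (≤-reflexive (+-comm 1 m)) (≤-trans (+-monoʳ-≤ m 1≤m) 2m≤n)

listA-sound : ∀ f {n m b} → 1 ≤ m → b ∈ listA f n m → InA n m b
listA-sound (suc f) {n} {m} 1≤m b∈ with m + m ≤? n | m ≤? n
... | yes 2m≤n | _ with ∈-++⁻ (map (m ∷_) (listA f (n ∸ m) m)) b∈
...   | inj₂ b∈rest = InA-weaken (listA-sound f (s≤s z≤n) b∈rest)
...   | inj₁ b∈map with ∈-map⁻ (m ∷_) b∈map
...     | c , c∈ , refl = InA-cons 1≤m (≤-trans (m≤m+n m m) 2m≤n) (listA-sound f 1≤m c∈)
listA-sound (suc f) 1≤m (here refl) | no _ | yes m≤n = InA-singleton 1≤m m≤n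

listA-complete : ∀ f {n m b} → 1 ≤ m → n < f + m → InA n m b → b ∈ listA f n m
listA-complete zero _ n<m b∈A = ⊥-elim (<⇒≱ n<m (InA⇒≤ b∈A))
listA-complete (suc f) {n} {m} 1≤m fuel b∈A with m + m ≤? n | m ≤? n
... | yes 2m≤n | _ with InA-split 1≤m 2m≤n b∈A
...   | inj₁ b∈A⁺ = ∈-++⁺ʳ _ (listA-complete f (s≤s z≤n) (fuel-next fuel) b∈A⁺)
...   | inj₂ (c , refl , c∈A) = ∈-++⁺ˡ (∈-map⁺ (m ∷_) (listA-complete f 1≤m (fuel-tail 1≤m fuel) c∈A))
listA-complete (suc f) 1≤m fuel b∈A | no 2m≰n | yes _ rewrite InA-short (≰⇒> 2m≰n) b∈A = here refl
listA-complete (suc f) 1≤m fuel b∈A | no _ | no m≰n = ⊥-elim (m≰n (InA⇒≤ b∈A))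

∈-listA⇔InA : ∀ f {n m b} → 1 ≤ m → n < f + m → b ∈ listA f n m ⇔ InA n m b
∈-listA⇔InA f 1≤m fuel = mk⇔ (listA-sound f 1≤m) (listA-complete f 1≤m fuel)

listA-sorted : ∀ f {n m} → 1 ≤ m → AllPairs _<lex_ (listA f n m)
listA-sorted zero _ = []
listA-sorted (suc f) {n} {m} 1≤m with m + m ≤? n | m ≤? n
... | yes _ | _ =
  AllPairs.++⁺ (AllPairs.map⁺ (AllPairs.map (next refl) (listA-sorted f 1≤m)))
               (listA-sorted f (s≤s z≤n))
               (All.tabulate λ x∈ → All.tabulate λ y∈ → m-block<next x∈ y∈)
  where
  m-block<next : ∀ {x y} → x ∈ map (m ∷_) (listA f (n ∸ m) m) → y ∈ listA f n (suc m) → x <lex y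
  m-block<next x∈ y∈ with ∈-map⁻ (m ∷_) x∈ | listA-sound f (s≤s z≤n) y∈
  ... | _ , _ , refl | inA _ _ _ m<a = this m<a
... | no _ | yes _ = All.[] ∷ []
... | no _ | no _  = []

lastOr : List ℕ → List (List ℕ) → List ℕ
lastOr p []       = p
lastOr _ (x ∷ xs) = lastOr x xs

suffixRest-++ : ∀ p xs ys → suffixRest p (xs ++ ys) ≡ suffixRest p xs + suffixRest (lastOr p xs) ys
suffixRest-++ p []       ys = refl
suffixRest-++ p (x ∷ xs) ys =
  trans (cong ((length x ∸ lcp p x) +_) (suffixRest-++ x xs ys))
        (sym (+-assoc (length x ∸ lcp p x) _ _))

lcp-∷ : ∀ m p x → lcp (m ∷ p) (m ∷ x) ≡ suc (lcp p x)
lcp-∷ m p x with m ≟ m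
... | yes _  = refl
... | no m≢m = ⊥-elim (m≢m refl)

suffixRest-map-∷ : ∀ m p xs → suffixRest (m ∷ p) (map (m ∷_) xs) ≡ suffixRest p xs
suffixRest-map-∷ m p []       = refl
suffixRest-map-∷ m p (x ∷ xs) rewrite lcp-∷ m p x =
  cong ((length x ∸ lcp p x) +_) (suffixRest-map-∷ m x xs)

lastOr-map-∷ : ∀ m p xs → lastOr (m ∷ p) (map (m ∷_) xs) ≡ m ∷ lastOr p xs
lastOr-map-∷ m p []       = refl
lastOr-map-∷ m p (x ∷ xs) = lastOr-map-∷ m x xs

HeadBelow : ℕ → List ℕ → Set
HeadBelow m []      = ⊤
HeadBelow m (x ∷ _) = x < m

lcp-HeadBelow : ∀ {m a} p {r} → HeadBelow m p → m ≤ a → lcp p (a ∷ r) ≡ 0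
lcp-HeadBelow []      _   _   = refl
lcp-HeadBelow {a = a} (x ∷ _) x<m m≤a with x ≟ a
... | yes refl = ⊥-elim (<⇒≱ x<m m≤a)
... | no _     = refl

-- S = 2N − 1 without truncated subtraction, for a listing continuing after any word p
-- whose first part is smaller than every first part in the listing.
SuffixFormula : ℕ → List (List ℕ) → Set
SuffixFormula m bs = ∀ p → HeadBelow m p → suc (suffixRest p bs) ≡ 2 * length bs

SuffixFormula-singleton : ∀ {m n} → m ≤ n → SuffixFormula m [ [ n ] ]
SuffixFormula-singleton m≤n p below rewrite lcp-HeadBelow p {[]} below m≤n = refl

suffixRest-map-∷-fresh : ∀ {m} p x xs → HeadBelow m p →
                         suffixRest p (map (m ∷_) (x ∷ xs)) ≡ suc (suffixRest [] (x ∷ xs))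
suffixRest-map-∷-fresh {m} p x xs below
  rewrite lcp-HeadBelow p {x} below ≤-refl | suffixRest-map-∷ m x xs = refl

SuffixFormula-join : ∀ {m xs ys} → SuffixFormula m xs → SuffixFormula (suc m) ys →
                     SuffixFormula m (map (m ∷_) xs ++ ys)
-- An empty listing violates the formula (1 ≢ 2 · 0), so xs has a first word.
SuffixFormula-join {xs = []} formula-xs _ _ _ with formula-xs [] _
... | ()
SuffixFormula-join {m} {x ∷ xs} {ys} formula-xs formula-ys p below = begin
  suc (suffixRest p (map (m ∷_) (x ∷ xs) ++ ys))
    ≡⟨ cong suc (suffixRest-++ p (map (m ∷_) (x ∷ xs)) ys) ⟩
  suc (suffixRest p (map (m ∷_) (x ∷ xs)) + suffixRest last ys)
    ≡⟨ cong (λ s → suc (s + suffixRest last ys)) (suffixRest-map-∷-fresh p x xs below) ⟩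
  suc (suc (suffixRest [] (x ∷ xs)) + suffixRest last ys)
    ≡⟨ sym (+-suc (suc (suffixRest [] (x ∷ xs))) (suffixRest last ys)) ⟩
  suc (suffixRest [] (x ∷ xs)) + suc (suffixRest last ys)
    ≡⟨ cong₂ _+_ (formula-xs [] _) (formula-ys last last-below) ⟩
  2 * length (x ∷ xs) + 2 * length ys
    ≡⟨ sym (*-distribˡ-+ 2 (length (x ∷ xs)) (length ys)) ⟩
  2 * (length (x ∷ xs) + length ys)
    ≡⟨ cong (λ k → 2 * (k + length ys)) (sym (length-map (m ∷_) (x ∷ xs))) ⟩
  2 * (length (map (m ∷_) (x ∷ xs)) + length ys)
    ≡⟨ cong (2 *_) (sym (length-++ (map (m ∷_) (x ∷ xs)))) ⟩
  2 * length (map (m ∷_) (x ∷ xs) ++ ys) ∎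
  where
  open ≡-Reasoning
  last : List ℕ
  last = lastOr p (map (m ∷_) (x ∷ xs))
  last-below : HeadBelow (suc m) last
  last-below rewrite lastOr-map-∷ m x xs = ≤-refl

listA-SuffixFormula : ∀ f {n m} → 1 ≤ m → m ≤ n → n < f + m → SuffixFormula m (listA f n m)
listA-SuffixFormula zero _ m≤n n<m = ⊥-elim (<⇒≱ n<m m≤n)
listA-SuffixFormula (suc f) {n} {m} 1≤m m≤n fuel with m + m ≤? n | m ≤? n
... | yes 2m≤n | _ =
  SuffixFormula-join {xs = listA f (n ∸ m) m} {ys = listA f n (suc m)}
    (listA-SuffixFormula f 1≤m (m+n≤o⇒m≤o∸n m 2m≤n) (fuel-tail 1≤m fuel))
    (listA-SuffixFormula f (s≤s z≤n) (1+m≤n 1≤m 2m≤n) (fuel-next fuel))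
... | no _ | yes _   = SuffixFormula-singleton m≤n
... | no _ | no m≰n  = ⊥-elim (m≰n m≤n)

suffixLength≡suffixRest[] : ∀ bs → suffixLength bs ≡ suffixRest [] bs
suffixLength≡suffixRest[] []      = refl
suffixLength≡suffixRest[] (_ ∷ _) = refl

theorem1 : (n m : ℕ) → 1 ≤ n → 1 ≤ m → m ≤ n →
    (L : List (List ℕ)) → Linked _<lex_ L → (∀ b → (b ∈ L) ⇔ InA n m b) →
    suffixLength L ≡ 2 * length L ∸ 1
theorem1 n m _ 1≤m m≤n L sorted L⇔A = begin
  suffixLength L               ≡⟨ suffixLength≡suffixRest[] L ⟩
  suffixRest [] L              ≡⟨ cong (_∸ 1) (subst (SuffixFormula m) (sym L≡listA) formula [] _) ⟩
  2 * length L ∸ 1             ∎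
  where
  open ≡-Reasoning
  fuel : n < suc n + m
  fuel = ≤-trans (n<1+n n) (m≤m+n (suc n) m)
  formula : SuffixFormula m (listA (suc n) n m)
  formula = listA-SuffixFormula (suc n) 1≤m m≤n fuel
  L≡listA : L ≡ listA (suc n) n m
  L≡listA = strictlySorted-unique <lex-asym (Linked⇒AllPairs <lex-trans sorted) (listA-sorted (suc n) 1≤m)
              (λ b → ⇔-sym (∈-listA⇔InA (suc n) 1≤m fuel) ⇔-∘ L⇔A b)
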